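{- For every signed graph $(G,\sigma)$ and every positive integer $k$, $\chi\big(\hat{G}^{[-k]}\big)\le \mathrm{dcol}_{2k}(G)$. Moreover, if $k$ is odd, then $\chi\big(\hat{G}^{[-k]}\big)\le \mathrm{dcol}_{2k-1}(G)$.
   Context: A signed graph $(G,\sigma)$ is a finite simple graph $G$ with $\sigma:E(G)\to\{+,-\}$; the sign of a path is the product of its edge signs. For a positive integer $k$, $\hat{G}^{[-k]}$ is the graph on $V(G)$ in which $xy$ is an edge iff $d_G(x,y)=k$ and every $xy$-path of length $k$ is negative. For a total ordering $L$ of $V(G)$, a positive integer $r$ and $y\in V(G)$, let $\mathrm{DReach}_r[G,L,y]$ be the set of vertices $x$ for which there is an $xy$-path $z_0z_1\cdots z_s$ with $z_0=x$, $z_s=y$, $s\le r$, such that $x$ is the $L$-minimum vertex of the path and $y\le_L z_i$ for all $\lfloor r/2\rfloor+1\le i\le s$. Then $\mathrm{dcol}_r(G)=\min_L\max_{v\in V(G)}|\mathrm{DReach}_r[G,L,v]|$. -}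

module Defs where

open import Data.Nat using (ℕ; zero; suc; _≤_; _<_; _*_; _∸_; _/_)
open import Data.Bool using (Bool; true; false)
open import Data.Fin using (Fin; toℕ; inject₁) renaming (zero to fzero; suc to fsuc)
open import Data.Product using (Σ; ∃; _×_; _,_)
open import Data.List using (List; length)
open import Data.List.Membership.Propositional using (_∈_)
open import Function.Definitions using (Injective)
open import Relation.Binary.PropositionalEquality using (_≡_; _≢_)
open import Relation.Nullary using (¬_)

data Sign : Set where
  plus minus : Sign

_·_ : Sign → Sign → Sign
plus  · s = s
minus · plus = minus
minus · minus = plus

record SignedGraph : Set where
  field
    n      : ℕ
    adj    : Fin n → Fin n → Bool
    adj-sym   : ∀ x y → adj x y ≡ adj y x
    adj-irrefl : ∀ x → adj x x ≡ false
    -- σ x y is the sign of the edge xy (only meaningful when xy is an edge)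
    σ      : Fin n → Fin n → Sign
    σ-sym  : ∀ x y → adj x y ≡ true → σ x y ≡ σ y x

module _ (G : SignedGraph) where
  open SignedGraph G

  Edge : Fin n → Fin n → Set
  Edge x y = adj x y ≡ true

  record Path (s : ℕ) : Set where
    field
      z      : Fin (suc s) → Fin n
      z-inj  : Injective _≡_ _≡_ z
      z-adj  : ∀ (i : Fin s) → Edge (z (inject₁ i)) (z (fsuc i))

  start : ∀ {s} → Path s → Fin n
  start p = Path.z p fzero

  end : ∀ {s} → Path s → Fin n
  end {s} p = Path.z p (Data.Fin.fromℕ s)

  signProd : (s : ℕ) → (Fin s → Sign) → Sign
  signProd zero    f = plus
  signProd (suc s) f = f fzero · signProd s (λ i → f (fsuc i))

  pathSign : ∀ {s} → Path s → Sign
  pathSign {s} p = signProd s (λ i → σ (Path.z p (inject₁ i)) (Path.z p (fsuc i)))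

  PathBetween : Fin n → Fin n → ℕ → Set
  PathBetween x y s = Σ (Path s) (λ p → start p ≡ x × end p ≡ y)

  Dist≡ : Fin n → Fin n → ℕ → Set
  Dist≡ x y k = PathBetween x y k × (∀ s → s < k → ¬ PathBetween x y s)

  -- the graph Ĝ^{[-k]} on V(G), as an adjacency relation
  NegPowerEdge : ℕ → Fin n → Fin n → Set
  NegPowerEdge k x y =
    Dist≡ x y k × (∀ (q : PathBetween x y k) → pathSign (Data.Product.proj₁ q) ≡ minus)

  record Ordering : Set where
    field
      pos     : Fin n → Fin n
      pos-inj : Injective _≡_ _≡_ pos

  _≤[_]_ : Fin n → Ordering → Fin n → Set
  x ≤[ L ] y = toℕ (Ordering.pos L x) ≤ toℕ (Ordering.pos L y)

  DReach : ℕ → Ordering → Fin n → Fin n → Set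
  DReach r L y x =
    Σ ℕ λ s → Σ (PathBetween x y s) λ q →
      s ≤ r
      × (∀ i → x ≤[ L ] Path.z (Data.Product.proj₁ q) i)
      × (∀ (i : Fin (suc s)) → suc (r / 2) ≤ toℕ i → y ≤[ L ] Path.z (Data.Product.proj₁ q) i)

  CardAtMost : (Fin n → Set) → ℕ → Set
  CardAtMost P m = Σ (List (Fin n)) λ xs → length xs ≤ m × (∀ x → P x → x ∈ xs)

  DReachBound : ℕ → Ordering → ℕ → Set
  DReachBound r L m = ∀ v → CardAtMost (DReach r L v) m

  IsDcol : ℕ → ℕ → Set
  IsDcol r d = (Σ Ordering λ L → DReachBound r L d)
             × (∀ L m → DReachBound r L m → d ≤ m)

ProperColouring : {N : ℕ} → (Fin N → Fin N → Set) → (m : ℕ) → (Fin N → Fin m) → Set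
ProperColouring E m c = ∀ x y → E x y → c x ≢ c y

Colourable : {N : ℕ} → (Fin N → Fin N → Set) → ℕ → Set
Colourable E m = Σ (Fin _ → Fin m) (ProperColouring E m)

IsChromaticNumber : {N : ℕ} → (Fin N → Fin N → Set) → ℕ → Set
IsChromaticNumber E c = Colourable E c × (∀ m → Colourable E m → c ≤ m)

-- Call u near v if some walk from v to u has length less than k/2, or length exactly k/2 and
-- positive sign, and let the anchor of v be the L-least vertex near v. If xy is an edge of
-- Ĝ^{[-k]}, no vertex is near both x and y (gluing the two walks would give an xy-walk that is
-- shorter than k or positive of length k), so x and y have distinct anchors; and every vertex of
-- a negative xy-path of length k is near x or near y, while those beyond its first ⌊k/2⌋ steps
-- are near y. Hence walking from the smaller anchor back to x, along the path, and on to the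
-- larger anchor stays above the smaller anchor, lies above the larger one after its first
-- r/2 steps, and has length at most k + 2⌊k/2⌋ ≤ r; shortcut to a path, it puts the smaller
-- anchor in the DReach_r-set of the larger. A greedy colouring along L that separates each vertex
-- from its DReach_r-set, composed with the anchor map, therefore properly colours Ĝ^{[-k]}.
-- Finally k + 2⌊k/2⌋ is 2k for even k and 2k − 1 for odd k.
module Submission where

open import Defs
open import Data.Bool using (true)
import Data.Bool.Properties as Bool
open import Data.Empty using (⊥; ⊥-elim)
open import Data.Fin using (Fin; toℕ; inject₁; fromℕ; fromℕ<; zero; suc)
import Data.Fin.Properties as Fin
open import Data.List using (List; []; _∷_; length; drop; filter; map; lookup; allFin)
open import Data.List.Extrema.Nat using (argmin; argmin-all; f[argmin]≤f[xs])
open import Data.List.Membership.Propositional using (_∈_; _∉_)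
open import Data.List.Membership.Propositional.Properties using (∈-allFin; ∈-filter⁺; ∈-map⁺)
open import Data.List.Properties using (filter-notAll; length-map)
open import Data.List.Relation.Binary.Sublist.Propositional using (_⊆_; []; _∷_; _∷ʳ_; ⊆-refl; ⊆-trans)
open import Data.List.Relation.Binary.Sublist.Propositional.Properties using (All-resp-⊆; drop⁺-⊆; drop⁺-≥)
open import Data.List.Relation.Unary.All as All using (All; []; _∷_)
open import Data.List.Relation.Unary.All.Properties using (¬Any⇒All¬; all-filter; drop⁺)
open import Data.List.Relation.Unary.AllPairs using ([]; _∷_)
open import Data.List.Relation.Unary.Any as Any using (here; there; index)
open import Data.List.Relation.Unary.Any.Properties using (lookup-index)
open import Data.List.Relation.Unary.Unique.Propositional using (Unique)
open import Data.Nat using (ℕ; zero; suc; _+_; _*_; _∸_; _%_; _/_; _≤_; _<_; _<?_; z≤n; s≤s; s≤s⁻¹)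
open import Data.Nat.Tactic.RingSolver using (solve-∀)
open import Data.Nat.DivMod using (m≡m%n+[m/n]*n; m%n<n; m*n/n≡m; m/n*n≤m; /-monoˡ-≤)
open import Data.Nat.Properties
open import Data.Product using (Σ; ∃; _×_; _,_; proj₁; proj₂; uncurry)
open import Data.Sum using (_⊎_; inj₁; inj₂; [_,_]′)
open import Data.Vec.Functional using (updateAt)
open import Data.Vec.Functional.Properties using (updateAt-updates; updateAt-minimal)
open import Function using (_∘_; const)
open import Function.Definitions using (Injective)
open import Relation.Binary.PropositionalEquality
open import Relation.Nullary using (Dec; yes; no)
open import Relation.Nullary.Decidable using (map′; _×-dec_; _⊎-dec_; ¬?)

·-assoc : ∀ a b c → (a · b) · c ≡ a · (b · c)
·-assoc plus  b     c     = refl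
·-assoc minus plus  c     = refl
·-assoc minus minus plus  = refl
·-assoc minus minus minus = refl

·-comm : ∀ a b → a · b ≡ b · a
·-comm plus  plus  = refl
·-comm plus  minus = refl
·-comm minus plus  = refl
·-comm minus minus = refl

·-identityʳ : ∀ a → a · plus ≡ a
·-identityʳ plus  = refl
·-identityʳ minus = refl

·≡minus⇒plus : ∀ a b → a · b ≡ minus → a ≡ plus ⊎ b ≡ plus
·≡minus⇒plus plus  b     _  = inj₁ refl
·≡minus⇒plus minus plus  _  = inj₂ refl
·≡minus⇒plus minus minus ()

_≟ˢ_ : (a b : Sign) → Dec (a ≡ b)
plus  ≟ˢ plus  = yes refl
plus  ≟ˢ minus = no λ ()
minus ≟ˢ plus  = no λ ()
minus ≟ˢ minus = yes refl

Unique-resp-⊇ : {A : Set} {xs ys : List A} → xs ⊆ ys → Unique ys → Unique xs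
Unique-resp-⊇ []             []           = []
Unique-resp-⊇ (y ∷ʳ xs⊆ys)   (_ ∷ ys!)     = Unique-resp-⊇ xs⊆ys ys!
Unique-resp-⊇ (refl ∷ xs⊆ys) (y∉ys ∷ ys!) = All-resp-⊆ xs⊆ys y∉ys ∷ Unique-resp-⊇ xs⊆ys ys!

fresh : ∀ {d} (ys : List (Fin d)) → length ys < d → ∃ λ c → c ∉ ys
fresh {d} ys ys<d = Fin.¬∀⟶∃¬ d (_∈ ys) (_∈? ys) covers⇒⊥
  where
  open import Data.List.Membership.DecPropositional (Fin._≟_ {d}) using (_∈?_)
  covers⇒⊥ : (∀ c → c ∈ ys) → ⊥
  covers⇒⊥ covers = <⇒≱ ys<d (Fin.injective⇒≤ index-injective)
    where
    index-injective : Injective _≡_ _≡_ (index ∘ covers)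
    index-injective {c} {c′} eq =
      trans (lookup-index (covers c)) (trans (cong (lookup ys) eq) (sym (lookup-index (covers c′))))

module _ (a b : ℕ) {k : ℕ} (a+b≡k : a + b ≡ k) where

  double-sum : 2 * a + 2 * b ≡ k + k
  double-sum = begin
    2 * a + 2 * b ≡⟨ sym (*-distribˡ-+ 2 a b) ⟩
    2 * (a + b)   ≡⟨ cong (2 *_) a+b≡k ⟩
    k + (k + 0)   ≡⟨ cong (k +_) (+-identityʳ k) ⟩
    k + k         ∎
    where open ≡-Reasoning

  half-complement-≤ : 2 * b ≤ k → k ≤ 2 * a
  half-complement-≤ 2b≤k = +-cancelʳ-≤ (2 * b) k (2 * a) (begin
    k + 2 * b     ≤⟨ +-monoʳ-≤ k 2b≤k ⟩
    k + k         ≡⟨ sym double-sum ⟩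
    2 * a + 2 * b ∎)
    where open ≤-Reasoning

  half-complement-≥ : k ≤ 2 * b → 2 * a ≤ k
  half-complement-≥ k≤2b = +-cancelʳ-≤ k (2 * a) k (begin
    2 * a + k     ≤⟨ +-monoʳ-≤ (2 * a) k≤2b ⟩
    2 * a + 2 * b ≡⟨ double-sum ⟩
    k + k         ∎)
    where open ≤-Reasoning

halves-≤⇒≡ : ∀ a b {k} → a + b ≡ k → 2 * a ≤ k → 2 * b ≤ k → 2 * a ≡ k × 2 * b ≡ k
halves-≤⇒≡ a b a+b≡k 2a≤k 2b≤k =
  ≤-antisym 2a≤k (half-complement-≤ a b a+b≡k 2b≤k) ,
  ≤-antisym 2b≤k (half-complement-≤ b a (trans (+-comm b a) a+b≡k) 2a≤k)

halves-≥⇒≡ : ∀ a b {k} → a + b ≡ k → k ≤ 2 * a → k ≤ 2 * b → 2 * a ≡ k × 2 * b ≡ k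
halves-≥⇒≡ a b a+b≡k k≤2a k≤2b =
  ≤-antisym (half-complement-≥ a b a+b≡k k≤2b) k≤2a ,
  ≤-antisym (half-complement-≥ b a (trans (+-comm b a) a+b≡k) k≤2a) k≤2b

half-+-≤ : ∀ a b {k} → 2 * a ≤ k → 2 * b ≤ k → a + b ≤ k
half-+-≤ a b {k} 2a≤k 2b≤k = *-cancelˡ-≤ 2 (begin
  2 * (a + b)   ≡⟨ *-distribˡ-+ 2 a b ⟩
  2 * a + 2 * b ≤⟨ +-mono-≤ 2a≤k 2b≤k ⟩
  k + k         ≡⟨ cong (k +_) (sym (+-identityʳ k)) ⟩
  2 * k         ∎)
  where open ≤-Reasoning

≤-half : ∀ a {m} → 2 * a ≤ m → a ≤ m / 2
≤-half a {m} 2a≤m = subst (_≤ m / 2) (m*n/n≡m a 2) (/-monoˡ-≤ 2 (subst (_≤ m) (*-comm 2 a) 2a≤m))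

twice-half-≤ : ∀ k → 2 * (k / 2) ≤ k
twice-half-≤ k = subst (_≤ k) (*-comm (k / 2) 2) (m/n*n≤m k 2)

≤-suc-twice-half : ∀ k → k ≤ suc (2 * (k / 2))
≤-suc-twice-half k = begin
  k                   ≡⟨ m≡m%n+[m/n]*n k 2 ⟩
  k % 2 + k / 2 * 2   ≤⟨ +-monoˡ-≤ (k / 2 * 2) (s≤s⁻¹ (m%n<n k 2)) ⟩
  1 + k / 2 * 2       ≡⟨ cong suc (*-comm (k / 2) 2) ⟩
  suc (2 * (k / 2))   ∎
  where open ≤-Reasoning

beyond-half : ∀ {s k} → s + suc (k / 2) ≤ k → 2 * s < k
beyond-half {s} {k} s+h<k = +-cancelʳ-≤ k (suc (2 * s)) k (begin
  suc (2 * s) + k               ≡⟨ sym (+-suc (2 * s) k) ⟩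
  2 * s + suc k                 ≤⟨ +-monoʳ-≤ (2 * s) (s≤s (≤-suc-twice-half k)) ⟩
  2 * s + (2 + 2 * (k / 2))     ≡⟨ cong (2 * s +_) (sym (*-distribˡ-+ 2 1 (k / 2))) ⟩
  2 * s + 2 * suc (k / 2)       ≡⟨ sym (*-distribˡ-+ 2 s (suc (k / 2))) ⟩
  2 * (s + suc (k / 2))         ≤⟨ *-monoʳ-≤ 2 s+h<k ⟩
  k + (k + 0)                   ≡⟨ cong (k +_) (+-identityʳ k) ⟩
  k + k                         ∎)
  where open ≤-Reasoning

detour-≤ : ∀ {a b k r} → a ≤ k / 2 → b ≤ k / 2 → k + 2 * (k / 2) ≤ r → a + (k + b) ≤ r
detour-≤ {a} {b} {k} {r} a≤h b≤h budget = begin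
  a + (k + b)         ≤⟨ +-mono-≤ a≤h (+-monoʳ-≤ k b≤h) ⟩
  k / 2 + (k + k / 2) ≡⟨ rearrange (k / 2) k ⟩
  k + 2 * (k / 2)     ≤⟨ budget ⟩
  r                   ∎
  where
  open ≤-Reasoning
  rearrange : ∀ h k → h + (k + h) ≡ k + 2 * h
  rearrange = solve-∀

half-detour-≤ : ∀ a {k r} → 2 * a ≤ k → k + 2 * (k / 2) ≤ r → a + k / 2 ≤ r / 2
half-detour-≤ a {k} {r} 2a≤k budget = ≤-half (a + k / 2) (begin
  2 * (a + k / 2)     ≡⟨ *-distribˡ-+ 2 a (k / 2) ⟩
  2 * a + 2 * (k / 2) ≤⟨ +-monoˡ-≤ (2 * (k / 2)) 2a≤k ⟩
  k + 2 * (k / 2)     ≤⟨ budget ⟩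
  r                   ∎)
  where open ≤-Reasoning

budget-≤-double : ∀ k → k + 2 * (k / 2) ≤ 2 * k
budget-≤-double k = begin
  k + 2 * (k / 2) ≤⟨ +-monoʳ-≤ k (twice-half-≤ k) ⟩
  k + k           ≡⟨ cong (k +_) (sym (+-identityʳ k)) ⟩
  2 * k           ∎
  where open ≤-Reasoning

budget-odd : ∀ k → k % 2 ≡ 1 → k + 2 * (k / 2) ≡ 2 * k ∸ 1
budget-odd k k-odd = begin
  k + 2 * (k / 2)   ≡⟨ cong (k +_) (*-comm 2 (k / 2)) ⟩
  k + (k / 2 * 2)   ≡⟨ cong (λ m → k + (m ∸ 1)) (sym k≡1+2h) ⟩
  k + (k ∸ 1)       ≡⟨ sym (+-∸-assoc k 1≤k) ⟩
  (k + k) ∸ 1       ≡⟨ cong (λ m → (k + m) ∸ 1) (sym (+-identityʳ k)) ⟩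
  2 * k ∸ 1         ∎
  where
  open ≡-Reasoning
  k≡1+2h : k ≡ 1 + k / 2 * 2
  k≡1+2h = trans (m≡m%n+[m/n]*n k 2) (cong (_+ k / 2 * 2) k-odd)
  1≤k : 1 ≤ k
  1≤k = subst (1 ≤_) (sym k≡1+2h) (s≤s z≤n)

data HalfShort (k ℓ : ℕ) (s : Sign) : Set where
  short : 2 * ℓ < k → HalfShort k ℓ s
  exact : 2 * ℓ ≡ k → s ≡ plus → HalfShort k ℓ s

HalfShort⇒≤ : ∀ {k ℓ s} → HalfShort k ℓ s → 2 * ℓ ≤ k
HalfShort⇒≤ (short 2ℓ<k)   = <⇒≤ 2ℓ<k
HalfShort⇒≤ (exact 2ℓ≡k _) = ≤-reflexive 2ℓ≡k

HalfShort-exact : ∀ {k ℓ s} → HalfShort k ℓ s → 2 * ℓ ≡ k → s ≡ plus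
HalfShort-exact (short 2ℓ<k)      2ℓ≡k = ⊥-elim (<⇒≢ 2ℓ<k 2ℓ≡k)
HalfShort-exact (exact _ s≡plus) _    = s≡plus

HalfShort-zero : ∀ k → HalfShort k 0 plus
HalfShort-zero zero    = exact refl refl
HalfShort-zero (suc k) = short (s≤s z≤n)

halfShort? : ∀ k ℓ s → Dec (HalfShort k ℓ s)
halfShort? k ℓ s =
  map′ [ short , uncurry exact ]′ from (2 * ℓ <? k ⊎-dec (2 * ℓ ≟ k ×-dec s ≟ˢ plus))
  where
  from : HalfShort k ℓ s → 2 * ℓ < k ⊎ (2 * ℓ ≡ k × s ≡ plus)
  from (short 2ℓ<k)        = inj₁ 2ℓ<k
  from (exact 2ℓ≡k s≡plus) = inj₂ (2ℓ≡k , s≡plus)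

module GreedyColouring {n d : ℕ} (pos : Fin n → Fin n) (pos-injective : Injective _≡_ _≡_ pos)
  (D : Fin n → Fin n → Set) (D-refl : ∀ v → D v v)
  (D-≤ : ∀ {v u} → D v u → toℕ (pos u) ≤ toℕ (pos v))
  (D-bounded : ∀ v → Σ (List (Fin n)) λ xs → length xs ≤ d × (∀ u → D v u → u ∈ xs)) where

  ProperUpTo : ℕ → (Fin n → Fin d) → Set
  ProperUpTo m c = ∀ {v u} → toℕ (pos v) < m → D v u → u ≢ v → c u ≢ c v

  private
    initial : Σ (Fin n → Fin d) (ProperUpTo 0)
    initial = (λ v → fromℕ< (d-positive v)) , λ ()
      where
      d-positive : Fin n → 0 < d
      d-positive v with D-bounded v
      ... | x ∷ _ , 1+xs≤d , _ = ≤-trans (s≤s z≤n) 1+xs≤d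
      ... | []    , _       , ∈xs with ∈xs v (D-refl v)
      ...   | ()

    extend : ∀ {m c} → ProperUpTo m c → Σ (Fin n → Fin d) (ProperUpTo (suc m))
    extend {m} {c} proper with Fin.any? (λ v → toℕ (pos v) ≟ m)
    ... | no none = c , λ v<1+m → proper (≤∧≢⇒< (s≤s⁻¹ v<1+m) (λ v≡m → none (_ , v≡m)))
    ... | yes (v₀ , v₀≡m) = updateAt c v₀ (const colour) , proper′
      where
      xs = proj₁ (D-bounded v₀)
      ∈xs = proj₂ (proj₂ (D-bounded v₀))
      v₀∈xs = ∈xs v₀ (D-refl v₀)
      others = filter (λ u → ¬? (u Fin.≟ v₀)) xs
      others<d : length (map c others) < d
      others<d = begin-strict
        length (map c others) ≡⟨ length-map c others ⟩
        length others         <⟨ filter-notAll _ xs (Any.map (λ v₀≡u u≢v₀ → u≢v₀ (sym v₀≡u)) v₀∈xs) ⟩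
        length xs             ≤⟨ proj₁ (proj₂ (D-bounded v₀)) ⟩
        d                     ∎
        where open ≤-Reasoning
      colour = proj₁ (fresh (map c others) others<d)
      colour∉ = proj₂ (fresh (map c others) others<d)
      proper′ : ProperUpTo (suc m) (updateAt c v₀ (const colour))
      proper′ {v} {u} v≤m vDu u≢v with v Fin.≟ v₀
      ... | yes refl = λ c′u≡c′v → colour∉ (subst (_∈ map c others)
            (trans (sym (updateAt-minimal u v c u≢v)) (trans c′u≡c′v (updateAt-updates v c)))
            (∈-map⁺ c (∈-filter⁺ _ (∈xs u vDu) u≢v)))
      ... | no v≢v₀ = λ c′u≡c′v → proper v<m vDu u≢v
            (trans (sym (updateAt-minimal u v₀ c u≢v₀))
              (trans c′u≡c′v (updateAt-minimal v v₀ c v≢v₀)))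
        where
        v<m : toℕ (pos v) < m
        v<m = ≤∧≢⇒< (s≤s⁻¹ v≤m) λ v≡m →
          v≢v₀ (pos-injective (Fin.toℕ-injective (trans v≡m (sym v₀≡m))))
        u≢v₀ : u ≢ v₀
        u≢v₀ refl = <⇒≢ (≤-<-trans (D-≤ vDu) v<m) v₀≡m

    properUpTo : ∀ m → Σ (Fin n → Fin d) (ProperUpTo m)
    properUpTo zero    = initial
    properUpTo (suc m) = extend (proj₂ (properUpTo m))

  greedy : Σ (Fin n → Fin d) λ c → ∀ {v u} → D v u → u ≢ v → c u ≢ c v
  greedy = let c , proper = properUpTo n in c , proper (Fin.toℕ<n (pos _))

module Walks (G : SignedGraph) where
  open SignedGraph G
  open import Data.List.Membership.DecPropositional (Fin._≟_ {n}) using (_∈?_)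

  Vertex : Set
  Vertex = Fin n

  infixr 5 _∷⟨_⟩_ _++ʷ_

  data Walk : Vertex → Vertex → Set where
    [_]    : ∀ v → Walk v v
    _∷⟨_⟩_ : ∀ u {v w} → Edge G u v → Walk v w → Walk u w

  private
    variable
      t u v w x y : Vertex
      P : Vertex → Set

  len : Walk u v → ℕ
  len [ _ ]         = 0
  len (_ ∷⟨ _ ⟩ p) = suc (len p)

  sign : Walk u v → Sign
  sign [ _ ]                  = plus
  sign (_∷⟨_⟩_ u {v} _ p) = σ u v · sign p

  arrivals : Walk u v → List Vertex
  arrivals [ _ ]                  = []
  arrivals (_∷⟨_⟩_ _ {v} _ p) = v ∷ arrivals p

  vertices : Walk u v → List Vertex
  vertices {u} p = u ∷ arrivals p

  _++ʷ_ : Walk u v → Walk v w → Walk u w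
  [ _ ]        ++ʷ q = q
  (u ∷⟨ e ⟩ p) ++ʷ q = u ∷⟨ e ⟩ (p ++ʷ q)

  reverse : Walk u v → Walk v u
  reverse [ v ]                 = [ v ]
  reverse (_∷⟨_⟩_ u {v} e p) = reverse p ++ʷ (v ∷⟨ trans (adj-sym v u) e ⟩ [ u ])

  len-++ʷ : (p : Walk u v) (q : Walk v w) → len (p ++ʷ q) ≡ len p + len q
  len-++ʷ [ _ ]        q = refl
  len-++ʷ (_ ∷⟨ _ ⟩ p) q = cong suc (len-++ʷ p q)

  sign-++ʷ : (p : Walk u v) (q : Walk v w) → sign (p ++ʷ q) ≡ sign p · sign q
  sign-++ʷ [ _ ]                  q = refl
  sign-++ʷ (_∷⟨_⟩_ u {v} _ p) q =
    trans (cong (σ u v ·_) (sign-++ʷ p q)) (sym (·-assoc (σ u v) (sign p) (sign q)))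

  len-reverse : (p : Walk u v) → len (reverse p) ≡ len p
  len-reverse [ _ ]                 = refl
  len-reverse (_∷⟨_⟩_ u {v} e p) = begin
    len (reverse p ++ʷ (v ∷⟨ _ ⟩ [ u ])) ≡⟨ len-++ʷ (reverse p) _ ⟩
    len (reverse p) + 1                  ≡⟨ +-comm (len (reverse p)) 1 ⟩
    suc (len (reverse p))                ≡⟨ cong suc (len-reverse p) ⟩
    suc (len p)                          ∎
    where open ≡-Reasoning

  sign-reverse : (p : Walk u v) → sign (reverse p) ≡ sign p
  sign-reverse [ _ ]                 = refl
  sign-reverse (_∷⟨_⟩_ u {v} e p) = begin
    sign (reverse p ++ʷ (v ∷⟨ _ ⟩ [ u ])) ≡⟨ sign-++ʷ (reverse p) _ ⟩
    sign (reverse p) · (σ v u · plus)     ≡⟨ cong₂ _·_ (sign-reverse p) (·-identityʳ (σ v u)) ⟩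
    sign p · σ v u                        ≡⟨ cong (sign p ·_) (sym (σ-sym u v e)) ⟩
    sign p · σ u v                        ≡⟨ ·-comm (sign p) (σ u v) ⟩
    σ u v · sign p                        ∎
    where open ≡-Reasoning

  All-drop-arrivals-++ʷ : ∀ j (p : Walk u v) {q : Walk v w} →
    All P (drop j (arrivals p)) → All P (arrivals q) → All P (drop j (arrivals (p ++ʷ q)))
  All-drop-arrivals-++ʷ j       [ _ ]        _          Pq = drop⁺ j Pq
  All-drop-arrivals-++ʷ zero    (_ ∷⟨ _ ⟩ p) (Pv ∷ Pp) Pq = Pv ∷ All-drop-arrivals-++ʷ zero p Pp Pq
  All-drop-arrivals-++ʷ (suc j) (_ ∷⟨ _ ⟩ p) Pp        Pq = All-drop-arrivals-++ʷ j p Pp Pq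

  All-drop-arrivals-++ʷ-beyond : ∀ {i j} (p : Walk u v) {q : Walk v w} → len p + j ≤ i →
    All P (drop j (arrivals q)) → All P (drop i (arrivals (p ++ʷ q)))
  All-drop-arrivals-++ʷ-beyond [ _ ] j≤i Pq = All-resp-⊆ (drop⁺-≥ j≤i) Pq
  All-drop-arrivals-++ʷ-beyond {i = suc i} (_ ∷⟨ _ ⟩ p) (s≤s p+j≤i) Pq =
    All-drop-arrivals-++ʷ-beyond p p+j≤i Pq

  All-vertices-++ʷ : (p : Walk u v) {q : Walk v w} →
    All P (vertices p) → All P (arrivals q) → All P (vertices (p ++ʷ q))
  All-vertices-++ʷ p (Pu ∷ Pp) Pq = Pu ∷ All-drop-arrivals-++ʷ zero p Pp Pq

  All-vertices-reverse : (p : Walk u v) → All P (vertices p) → All P (vertices (reverse p))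
  All-vertices-reverse [ _ ]        Pp        = Pp
  All-vertices-reverse (_ ∷⟨ _ ⟩ p) (Pu ∷ Pp) =
    All-vertices-++ʷ (reverse p) (All-vertices-reverse p Pp) (Pu ∷ [])

  dropUntil : (p : Walk u v) → t ∈ vertices p →
    Σ (Walk t v) λ q → vertices q ⊆ vertices p × len q ≤ len p
  dropUntil p (here refl) = p , ⊆-refl , ≤-refl
  dropUntil (u ∷⟨ _ ⟩ p) (there t∈p) with dropUntil p t∈p
  ... | q , q⊆p , q≤p = q , u ∷ʳ q⊆p , m≤n⇒m≤1+n q≤p

  _≼_ : Walk u v → Walk u v → Set
  q ≼ p = len q < len p ⊎ q ≡ p

  ≼⇒len≤ : {q p : Walk u v} → q ≼ p → len q ≤ len p
  ≼⇒len≤ (inj₁ q<p)  = <⇒≤ q<p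
  ≼⇒len≤ (inj₂ refl) = ≤-refl

  shortcut : (p : Walk u v) → Σ (Walk u v) λ q → Unique (vertices q) × vertices q ⊆ vertices p × q ≼ p
  shortcut [ v ] = [ v ] , [] ∷ [] , ⊆-refl , inj₂ refl
  shortcut (u ∷⟨ e ⟩ p) with shortcut p
  ... | q , q! , q⊆p , q≼p with u ∈? vertices q
  ...   | yes u∈q =
    let q′ , q′⊆q , q′≤q = dropUntil q u∈q
    in q′ , Unique-resp-⊇ q′⊆q q! , u ∷ʳ ⊆-trans q′⊆q q⊆p ,
       inj₁ (s≤s (≤-trans q′≤q (≼⇒len≤ q≼p)))
  ...   | no u∉q = u ∷⟨ e ⟩ q , ¬Any⇒All¬ _ u∉q ∷ q! , refl ∷ q⊆p , extend q≼p
    where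
    extend : q ≼ p → (u ∷⟨ e ⟩ q) ≼ (u ∷⟨ e ⟩ p)
    extend (inj₁ q<p)  = inj₁ (s≤s q<p)
    extend (inj₂ refl) = inj₂ refl

  vertexAt : (p : Walk u v) → Fin (suc (len p)) → Vertex
  vertexAt [ v ]        _       = v
  vertexAt (u ∷⟨ _ ⟩ p) zero    = u
  vertexAt (u ∷⟨ _ ⟩ p) (suc i) = vertexAt p i

  vertexAt-zero : (p : Walk u v) → vertexAt p zero ≡ u
  vertexAt-zero [ _ ]        = refl
  vertexAt-zero (_ ∷⟨ _ ⟩ _) = refl

  vertexAt-last : (p : Walk u v) → vertexAt p (fromℕ (len p)) ≡ v
  vertexAt-last [ _ ]        = refl
  vertexAt-last (_ ∷⟨ _ ⟩ p) = vertexAt-last p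

  vertexAt-∈ : (p : Walk u v) (i : Fin (suc (len p))) → vertexAt p i ∈ vertices p
  vertexAt-∈ [ v ]        _       = here refl
  vertexAt-∈ (u ∷⟨ _ ⟩ p) zero    = here refl
  vertexAt-∈ (u ∷⟨ _ ⟩ p) (suc i) = there (vertexAt-∈ p i)

  vertexAt-injective : (p : Walk u v) → Unique (vertices p) → Injective _≡_ _≡_ (vertexAt p)
  vertexAt-injective [ _ ]        _          {zero}  {zero}  _  = refl
  vertexAt-injective (_ ∷⟨ _ ⟩ p) _          {zero}  {zero}  _  = refl
  vertexAt-injective (_ ∷⟨ _ ⟩ p) (u∉p ∷ _) {zero}  {suc j} eq =
    ⊥-elim (All.lookup u∉p (vertexAt-∈ p j) eq)
  vertexAt-injective (_ ∷⟨ _ ⟩ p) (u∉p ∷ _) {suc i} {zero}  eq =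
    ⊥-elim (All.lookup u∉p (vertexAt-∈ p i) (sym eq))
  vertexAt-injective (_ ∷⟨ _ ⟩ p) (_ ∷ p!)  {suc i} {suc j} eq = cong suc (vertexAt-injective p p! eq)

  vertexAt-edge : (p : Walk u v) (i : Fin (len p)) → Edge G (vertexAt p (inject₁ i)) (vertexAt p (suc i))
  vertexAt-edge (u ∷⟨ e ⟩ p) zero    = subst (Edge G u) (sym (vertexAt-zero p)) e
  vertexAt-edge (_ ∷⟨ _ ⟩ p) (suc i) = vertexAt-edge p i

  vertexAt-sign : (p : Walk u v) →
    signProd G (len p) (λ i → σ (vertexAt p (inject₁ i)) (vertexAt p (suc i))) ≡ sign p
  vertexAt-sign [ _ ]        = refl
  vertexAt-sign (u ∷⟨ _ ⟩ p) = cong₂ _·_ (cong (σ u) (vertexAt-zero p)) (vertexAt-sign p)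

  All-drop-vertexAt : ∀ {j} (p : Walk u v) → All P (drop j (vertices p)) →
    (i : Fin (suc (len p))) → j ≤ toℕ i → P (vertexAt p i)
  All-drop-vertexAt {j = zero}  [ _ ]        (Pv ∷ _)  _       _         = Pv
  All-drop-vertexAt {j = zero}  (_ ∷⟨ _ ⟩ _) (Pu ∷ _)  zero    _         = Pu
  All-drop-vertexAt {j = zero}  (_ ∷⟨ _ ⟩ p) (_ ∷ Pp)  (suc i) _         = All-drop-vertexAt p Pp i z≤n
  All-drop-vertexAt {j = suc j} (_ ∷⟨ _ ⟩ p) Pp        (suc i) (s≤s j≤i) = All-drop-vertexAt p Pp i j≤i

  walk⇒path : (p : Walk u v) → Unique (vertices p) → PathBetween G u v (len p)
  walk⇒path p p! = path , vertexAt-zero p , vertexAt-last p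
    where
    path : Path G (len p)
    path = record { z = vertexAt p ; z-inj = vertexAt-injective p p! ; z-adj = vertexAt-edge p }

  path⇒walk : ∀ {k} (q : PathBetween G x y k) →
    Σ (Walk x y) λ p → len p ≡ k × sign p ≡ pathSign G (proj₁ q)
  path⇒walk {k = k} (path , refl , refl) = along k (Path.z path) (Path.z-adj path)
    where
    along : ∀ k (z : Fin (suc k) → Vertex) (adjacent : ∀ i → Edge G (z (inject₁ i)) (z (suc i))) →
      Σ (Walk (z zero) (z (fromℕ k))) λ p →
        len p ≡ k × sign p ≡ signProd G k (λ i → σ (z (inject₁ i)) (z (suc i)))
    along zero    z _        = [ z zero ] , refl , refl
    along (suc k) z adjacent with along k (z ∘ suc) (adjacent ∘ suc)
    ... | p , len-p , sign-p =
      z zero ∷⟨ adjacent zero ⟩ p , cong suc len-p , cong (σ (z zero) (z (suc zero)) ·_) sign-p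

  record Split (p : Walk u v) (t : Vertex) : Set where
    field
      prefix    : Walk u t
      suffix    : Walk t v
      len-split  : len prefix + len suffix ≡ len p
      sign-split : sign prefix · sign suffix ≡ sign p

  splits : (p : Walk u v) → All (Split p) (vertices p)
  splits [ v ]        = record { prefix = [ v ] ; suffix = [ v ] ; len-split = refl ; sign-split = refl } ∷ []
  splits (u ∷⟨ e ⟩ p) =
    record { prefix = [ u ] ; suffix = u ∷⟨ e ⟩ p ; len-split = refl ; sign-split = refl }
    ∷ All.map extend (splits p)
    where
    extend : Split p t → Split (u ∷⟨ e ⟩ p) t
    extend s = record
      { prefix    = u ∷⟨ e ⟩ prefix
      ; suffix    = suffix
      ; len-split  = cong suc len-split
      ; sign-split = trans (·-assoc _ (sign prefix) (sign suffix)) (cong (_ ·_) sign-split)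
      }
      where open Split s

  suffixesAfter : ∀ j (p : Walk u v) →
    All (λ t → Σ (Walk t v) λ q → len q + j ≤ len p) (drop j (vertices p))
  suffixesAfter zero    [ v ]        = ([ v ] , z≤n) ∷ []
  suffixesAfter (suc j) [ v ]        = drop⁺ j []
  suffixesAfter zero    (u ∷⟨ e ⟩ p) =
    (u ∷⟨ e ⟩ p , ≤-reflexive (+-identityʳ _))
    ∷ All.map (λ (q , q≤p) → q , m≤n⇒m≤1+n q≤p) (suffixesAfter zero p)
  suffixesAfter (suc j) (u ∷⟨ e ⟩ p) =
    All.map (λ (q , q+j≤p) → q , ≤-trans (≤-reflexive (+-suc (len q) j)) (s≤s q+j≤p)) (suffixesAfter j p)

  BoundedWalk : (ℕ → Sign → Set) → ℕ → Vertex → Vertex → Set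
  BoundedWalk Q ℓ u v = Σ (Walk u v) λ p → len p ≤ ℓ × Q (len p) (sign p)

  boundedWalk? : ∀ Q → (∀ ℓ s → Dec (Q ℓ s)) → ∀ ℓ u v → Dec (BoundedWalk Q ℓ u v)
  boundedWalk? Q Q? ℓ u v = map′ join split ((u Fin.≟ v ×-dec Q? 0 plus) ⊎-dec step? ℓ)
    where
    Step : ℕ → Set
    Step zero    = ⊥
    Step (suc ℓ) = ∃ λ t → Edge G u t × BoundedWalk (λ ℓ s → Q (suc ℓ) (σ u t · s)) ℓ t v

    step? : ∀ ℓ → Dec (Step ℓ)
    step? zero    = no λ ()
    step? (suc ℓ) = Fin.any? λ t → (adj u t Bool.≟ true) ×-dec
      boundedWalk? (λ ℓ s → Q (suc ℓ) (σ u t · s)) (λ ℓ s → Q? (suc ℓ) (σ u t · s)) ℓ t v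

    join : ∀ {ℓ} → (u ≡ v × Q 0 plus) ⊎ Step ℓ → BoundedWalk Q ℓ u v
    join         (inj₁ (refl , q))               = [ u ] , z≤n , q
    join {suc ℓ} (inj₂ (t , e , p , p≤ℓ , q)) = u ∷⟨ e ⟩ p , s≤s p≤ℓ , q

    split : ∀ {ℓ} → BoundedWalk Q ℓ u v → (u ≡ v × Q 0 plus) ⊎ Step ℓ
    split         ([ _ ] , _ , q)                       = inj₁ (refl , q)
    split {suc ℓ} (_∷⟨_⟩_ _ {t} e p , s≤s p≤ℓ , q) = inj₂ (t , e , p , p≤ℓ , q)

  record NegativeDistance (k : ℕ) (x y : Vertex) : Set where
    field
      walk     : Walk x y
      len-walk : len walk ≡ k
      shortest : ∀ p → len p ≤ k → len p ≡ k × sign p ≡ minus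

    sign-walk : sign walk ≡ minus
    sign-walk = proj₂ (shortest walk (≤-reflexive len-walk))

  NegativeDistance-sym : ∀ {k} → NegativeDistance k x y → NegativeDistance k y x
  NegativeDistance-sym {k = k} d = record
    { walk     = reverse walk
    ; len-walk = trans (len-reverse walk) len-walk
    ; shortest = λ p p≤k →
        let len-p , sign-p = shortest (reverse p) (subst (_≤ k) (sym (len-reverse p)) p≤k)
        in trans (sym (len-reverse p)) len-p , trans (sym (sign-reverse p)) sign-p
    }
    where open NegativeDistance d

  negPowerEdge⇒NegativeDistance : ∀ {k} → NegPowerEdge G k x y → NegativeDistance k x y
  negPowerEdge⇒NegativeDistance {x = x} {y} {k} ((q , no-shorter) , negative) = record
    { walk     = proj₁ (path⇒walk q)
    ; len-walk = proj₁ (proj₂ (path⇒walk q))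
    ; shortest = shortest
    }
    where
    negative-path : (p : Walk x y) (p! : Unique (vertices p)) → len p ≡ k → sign p ≡ minus
    negative-path p p! refl = trans (sym (vertexAt-sign p)) (negative (walk⇒path p p!))
    shortest : ∀ p → len p ≤ k → len p ≡ k × sign p ≡ minus
    shortest p p≤k with shortcut p
    ... | p′ , p′! , _ , inj₁ p′<p =
      ⊥-elim (no-shorter _ (<-≤-trans p′<p p≤k) (walk⇒path p′ p′!))
    ... | p , p! , _ , inj₂ refl with m≤n⇒m<n∨m≡n p≤k
    ...   | inj₁ p<k   = ⊥-elim (no-shorter _ p<k (walk⇒path p p!))
    ...   | inj₂ len-p = len-p , negative-path p p! len-p

  module Ordered (L : Ordering G) where
    open Ordering L

    _≤L_ : Vertex → Vertex → Set
    u ≤L v = toℕ (pos u) ≤ toℕ (pos v)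

    walk⇒DReach : ∀ {r} (p : Walk x y) → len p ≤ r → All (x ≤L_) (vertices p) →
      All (y ≤L_) (drop (suc (r / 2)) (vertices p)) → DReach G r L y x
    walk⇒DReach {r = r} p p≤r above-x late-above-y with shortcut p
    ... | q , q! , q⊆p , q≼p =
      len q , walk⇒path q q! , ≤-trans (≼⇒len≤ q≼p) p≤r ,
      (λ i → All-drop-vertexAt q (All-resp-⊆ q⊆p above-x) i z≤n) ,
      All-drop-vertexAt q (All-resp-⊆ (drop⁺-⊆ (suc (r / 2)) q⊆p) late-above-y)

    DReach-refl : ∀ {r} v → DReach G r L v v
    DReach-refl {r} v = walk⇒DReach [ v ] z≤n (≤-refl ∷ []) (drop⁺ (suc (r / 2)) (≤-refl ∷ []))

    DReach-≤ : ∀ {r} → DReach G r L y x → x ≤L y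
    DReach-≤ (s , (_ , _ , end≡y) , _ , above-x , _) =
      subst (λ t → toℕ (pos _) ≤ toℕ (pos t)) end≡y (above-x (fromℕ s))

module HalfBalls (G : SignedGraph) (k : ℕ) where
  open Walks G
  open NegativeDistance

  private
    variable
      t u v x y : Vertex

  Near : Vertex → Vertex → Set
  Near v u = Σ (Walk v u) λ p → HalfShort k (len p) (sign p)

  near-refl : ∀ v → Near v v
  near-refl v = [ v ] , HalfShort-zero k

  near? : ∀ v u → Dec (Near v u)
  near? v u = map′ (λ (p , _ , half) → p , half)
                   (λ (p , half) → p , ≤-trans (m≤m+n (len p) _) (HalfShort⇒≤ half) , half)
                   (boundedWalk? (HalfShort k) (halfShort? k) k v u)

  near-reverse : (p : Walk u v) → HalfShort k (len p) (sign p) → Near v u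
  near-reverse p half = reverse p , subst₂ (HalfShort k) (sym (len-reverse p)) (sym (sign-reverse p)) half

  near-along : ((p , _) : Near v u) → All (λ t → Near v t ⊎ t ≡ u) (vertices p)
  near-along {v} {u} (p , half) = All.map along (splits p)
    where
    along : ∀ {t} → Split p t → Near v t ⊎ t ≡ u
    along record { suffix = [ _ ] } = inj₂ refl
    along record { prefix = a ; suffix = _ ∷⟨ _ ⟩ _ ; len-split = a+b≡p } =
      inj₁ (a , short (<-≤-trans (*-monoʳ-< 2 a<p) (HalfShort⇒≤ half)))
      where a<p = ≤-trans (m<m+n (len a) (s≤s z≤n)) (≤-reflexive a+b≡p)

  near-disjoint : NegativeDistance k x y → Near x t → Near y t → ⊥
  near-disjoint d (a , a-half) (b , b-half) =
    plus≢minus (trans (sym sign-p≡plus) (proj₂ (shortest d p p≤k)))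
    where
    plus≢minus : plus ≢ minus
    plus≢minus ()
    p = a ++ʷ reverse b
    len-p : len p ≡ len a + len b
    len-p = trans (len-++ʷ a (reverse b)) (cong (len a +_) (len-reverse b))
    p≤k : len p ≤ k
    p≤k = subst (_≤ k) (sym len-p)
            (half-+-≤ (len a) (len b) (HalfShort⇒≤ a-half) (HalfShort⇒≤ b-half))
    exact-halves : 2 * len a ≡ k × 2 * len b ≡ k
    exact-halves = halves-≤⇒≡ (len a) (len b) (trans (sym len-p) (proj₁ (shortest d p p≤k)))
                     (HalfShort⇒≤ a-half) (HalfShort⇒≤ b-half)
    sign-p≡plus : sign p ≡ plus
    sign-p≡plus = begin
      sign (a ++ʷ reverse b)    ≡⟨ sign-++ʷ a (reverse b) ⟩
      sign a · sign (reverse b) ≡⟨ cong (sign a ·_) (sign-reverse b) ⟩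
      sign a · sign b           ≡⟨ cong₂ _·_ (HalfShort-exact a-half (proj₁ exact-halves))
                                             (HalfShort-exact b-half (proj₂ exact-halves)) ⟩
      plus                      ∎
      where open ≡-Reasoning

  near-along-negative : (d : NegativeDistance k x y) → All (λ t → Near x t ⊎ Near y t) (vertices (walk d))
  near-along-negative {x} {y} d = All.map along (splits (walk d))
    where
    along : ∀ {t} → Split (walk d) t → Near x t ⊎ Near y t
    along record { prefix = a ; suffix = b ; len-split = a+b≡p ; sign-split = sign-ab }
      with 2 * len a <? k | 2 * len b <? k
    ... | yes 2a<k | _        = inj₁ (a , short 2a<k)
    ... | no _     | yes 2b<k = inj₂ (near-reverse b (short 2b<k))
    ... | no 2a≮k  | no 2b≮k
      with halves-≥⇒≡ (len a) (len b) (trans a+b≡p (len-walk d)) (≮⇒≥ 2a≮k) (≮⇒≥ 2b≮k)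
         | ·≡minus⇒plus (sign a) (sign b) (trans sign-ab (sign-walk d))
    ...   | 2a≡k , _ | inj₁ a⁺ = inj₁ (a , exact 2a≡k a⁺)
    ...   | _ , 2b≡k | inj₂ b⁺ = inj₂ (near-reverse b (exact 2b≡k b⁺))

  near-beyond-half : (p : Walk x y) → len p ≤ k → All (Near y) (drop (suc (k / 2)) (vertices p))
  near-beyond-half p p≤k =
    All.map (λ (q , q+h<p) → near-reverse q (short (beyond-half (≤-trans q+h<p p≤k)))) (suffixesAfter _ p)

module Anchors (G : SignedGraph) (L : Ordering G) (k : ℕ) where
  open SignedGraph G using (n)
  open Ordering L
  open Walks G
  open Ordered L
  open HalfBalls G k
  open NegativeDistance

  private
    variable
      u v x y : Vertex

  anchor : Vertex → Vertex
  anchor v = argmin (toℕ ∘ pos) v (filter (near? v) (allFin n))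

  anchor-near : ∀ v → Near v (anchor v)
  anchor-near v = argmin-all (toℕ ∘ pos) (near-refl v) (all-filter (near? v) (allFin n))

  anchor-minimal : Near v u → anchor v ≤L u
  anchor-minimal {v} {u} v~u =
    All.lookup (f[argmin]≤f[xs] v (filter (near? v) (allFin n))) (∈-filter⁺ (near? v) (∈-allFin u) v~u)

  anchor-below-walk : ∀ v → All (anchor v ≤L_) (vertices (proj₁ (anchor-near v)))
  anchor-below-walk v = All.map below (near-along (anchor-near v))
    where
    below : ∀ {t} → Near v t ⊎ t ≡ anchor v → anchor v ≤L t
    below (inj₁ v~t)  = anchor-minimal v~t
    below (inj₂ refl) = ≤-refl

  anchors-distinct : NegativeDistance k x y → anchor x ≢ anchor y
  anchors-distinct {x} {y} d ax≡ay =
    near-disjoint d (anchor-near x) (subst (Near y) (sym ax≡ay) (anchor-near y))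

  anchor-reaches : ∀ {r} → k + 2 * (k / 2) ≤ r → NegativeDistance k x y → anchor x ≤L anchor y →
    DReach G r L (anchor y) (anchor x)
  anchor-reaches {x} {y} {r} budget d ax≤ay = walk⇒DReach W W≤r above-ax late-above-ay
    where
    Ax = proj₁ (anchor-near x)
    By = proj₁ (anchor-near y)
    2Ax≤k : 2 * len Ax ≤ k
    2Ax≤k = HalfShort⇒≤ (proj₂ (anchor-near x))

    W : Walk (anchor x) (anchor y)
    W = reverse Ax ++ʷ walk d ++ʷ By

    W≤r : len W ≤ r
    W≤r = begin
      len W                                  ≡⟨ len-++ʷ (reverse Ax) _ ⟩
      len (reverse Ax) + len (walk d ++ʷ By) ≡⟨ cong₂ _+_ (len-reverse Ax) (len-++ʷ (walk d) By) ⟩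
      len Ax + (len (walk d) + len By)       ≡⟨ cong (λ ℓ → len Ax + (ℓ + len By)) (len-walk d) ⟩
      len Ax + (k + len By)                  ≤⟨ detour-≤ (≤-half (len Ax) 2Ax≤k)
                                                  (≤-half (len By) (HalfShort⇒≤ (proj₂ (anchor-near y)))) budget ⟩
      r                                      ∎
      where open ≤-Reasoning

    above-ax : All (anchor x ≤L_) (vertices W)
    above-ax = All-vertices-++ʷ (reverse Ax) (All-vertices-reverse Ax (anchor-below-walk x))
      (All.tail (All-vertices-++ʷ (walk d) (All.map near-either (near-along-negative d))
        (All.tail (All.map (≤-trans ax≤ay) (anchor-below-walk y)))))
      where
      near-either : ∀ {t} → Near x t ⊎ Near y t → anchor x ≤L t
      near-either (inj₁ x~t) = anchor-minimal x~t
      near-either (inj₂ y~t) = ≤-trans ax≤ay (anchor-minimal y~t)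

    late-above-ay : All (anchor y ≤L_) (drop (suc (r / 2)) (vertices W))
    late-above-ay = All-drop-arrivals-++ʷ-beyond (reverse Ax)
      (subst (λ ℓ → ℓ + k / 2 ≤ r / 2) (sym (len-reverse Ax)) (half-detour-≤ (len Ax) 2Ax≤k budget))
      (All-drop-arrivals-++ʷ (k / 2) (walk d)
        (All.map anchor-minimal (near-beyond-half (walk d) (≤-reflexive (len-walk d))))
        (All.tail (anchor-below-walk y)))

  negPower-colourable : ∀ {r d} → k + 2 * (k / 2) ≤ r → DReachBound G r L d →
    Colourable (NegPowerEdge G k) d
  negPower-colourable {r} {d} budget bounded = colour ∘ anchor , proper
    where
    open GreedyColouring pos pos-inj (DReach G r L) DReach-refl DReach-≤ bounded using (greedy)
    colour = proj₁ greedy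
    proper : ProperColouring (NegPowerEdge G k) d (colour ∘ anchor)
    proper x y xy with ≤-total (toℕ (pos (anchor x))) (toℕ (pos (anchor y)))
    ... | inj₁ ax≤ay = proj₂ greedy (anchor-reaches budget dxy ax≤ay) (anchors-distinct dxy)
      where dxy = negPowerEdge⇒NegativeDistance xy
    ... | inj₂ ay≤ax = proj₂ greedy (anchor-reaches budget dyx ay≤ax) (anchors-distinct dyx) ∘ sym
      where dyx = NegativeDistance-sym (negPowerEdge⇒NegativeDistance xy)

theorem9 : (G : SignedGraph) (k : ℕ) → 1 ≤ k →
    ∀ c → IsChromaticNumber (NegPowerEdge G k) c →
      (∀ d → IsDcol G (2 * k) d → c ≤ d)
      × (k % 2 ≡ 1 → ∀ d → IsDcol G (2 * k ∸ 1) d → c ≤ d)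
theorem9 G k _ c (_ , minimal) =
  (λ d ((L , bounded) , _) → minimal d (negPower-colourable L k (budget-≤-double k) bounded)) ,
  (λ k-odd d ((L , bounded) , _) →
    minimal d (negPower-colourable L k (≤-reflexive (budget-odd k k-odd)) bounded))
  where open Anchors G
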